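{- Let $k\ge 2$ and let $B$ be a brick (with its canonical coloring) of color $c_1\in\{0,\dots,k-1\}$, and let $c_2\in\{0,\dots,k-1\}$ with $c_2\ne c_1$. Then by changing the colors of exactly $3$ edges of $B$ one obtains a proper $k$-edge-coloring of $B$ (with colors $0,\dots,k-1$) in which color $c_2$ is missing at both endpoints of $B$ (i.e., $B$ has color $c_2$), while every other node of $B$ is incident to an edge of every color.
   Context: Let $w$ be the unique power of $2$ with $w/2<k\le w$. A colorless-brick is the bipartite graph with left nodes and right nodes each numbered $0,\dots,w-1$, whose edges are colored with colors $0,\dots,k-1$ as follows: for each color $c$, the edges of color $c$ match left node $i$ with right node $i\oplus c$ for all $i$, where $\oplus$ is bitwise exclusive-or. (Each color class is a perfect matching and the color classes are disjoint.) A brick is obtained from a colorless-brick by deleting a single edge; its color is the color of the deleted edge, and its two endpoints are the two nodes (now of degree $k-1$) that were incident to the deleted edge. The color of a brick under any proper $k$-edge-coloring is the color missing at its endpoints. -}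

module Defs where

open import Data.Nat using (ℕ; zero; suc; _+_; _*_; _%_; _/_)
open import Data.Fin using (Fin; toℕ)
open import Data.Sum using (_⊎_; inj₁; inj₂)
open import Data.Product using (Σ; _×_; _,_; proj₁; proj₂)
open import Relation.Nullary using (¬_)
open import Relation.Binary.PropositionalEquality using (_≡_)

-- Bitwise exclusive-or on ℕ, computed bit by bit (least significant bit
-- first).  The fuel argument (m + n) is always sufficient, since each step
-- halves both arguments and xor 0 0 = 0.
xorAux : ℕ → ℕ → ℕ → ℕ
xorAux zero    m n = 0
xorAux (suc f) m n = ((m % 2) + (n % 2)) % 2 + 2 * xorAux f (m / 2) (n / 2)

_⊕_ : ℕ → ℕ → ℕ
m ⊕ n = xorAux (m + n) m n

infixl 6 _⊕_

Node : ℕ → Set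
Node w = Fin w ⊎ Fin w

-- Edges of the brick obtained from the colorless-brick (parameters w, k) by
-- deleting the edge of color c₁ at left node i₀.  An edge of the
-- colorless-brick is given by its left endpoint i and its (canonical) color c;
-- its right endpoint is the right node i ⊕ c.
BrickEdge : (w k : ℕ) → Fin w → Fin k → Set
BrickEdge w k i₀ c₁ = Σ (Fin w × Fin k) λ p → ¬ (proj₁ p ≡ i₀ × proj₂ p ≡ c₁)

module _ {w k : ℕ} {i₀ : Fin w} {c₁ : Fin k} where

  key : BrickEdge w k i₀ c₁ → Fin w × Fin k
  key e = proj₁ e

  leftEnd : BrickEdge w k i₀ c₁ → Fin w
  leftEnd e = proj₁ (proj₁ e)

  canonical : BrickEdge w k i₀ c₁ → Fin k
  canonical e = proj₂ (proj₁ e)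

  Incident : Node w → BrickEdge w k i₀ c₁ → Set
  Incident (inj₁ i) e = leftEnd e ≡ i
  Incident (inj₂ j) e = toℕ j ≡ toℕ (leftEnd e) ⊕ toℕ (canonical e)

  IsEndpoint : Node w → Set
  IsEndpoint (inj₁ i) = i ≡ i₀
  IsEndpoint (inj₂ j) = toℕ j ≡ toℕ i₀ ⊕ toℕ c₁

  Coloring : Set
  Coloring = BrickEdge w k i₀ c₁ → Fin k

  Proper : Coloring → Set
  Proper f = ∀ v e e′ → Incident v e → Incident v e′ → key e ≢ key e′ → f e ≢ f e′
    where
    _≢_ : ∀ {A : Set} → A → A → Set
    x ≢ y = ¬ (x ≡ y)

  ChangedExactly : Coloring → BrickEdge w k i₀ c₁ → BrickEdge w k i₀ c₁ → BrickEdge w k i₀ c₁ → Set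
  ChangedExactly f e₁ e₂ e₃ =
    ¬ (key e₁ ≡ key e₂) × ¬ (key e₁ ≡ key e₃) × ¬ (key e₂ ≡ key e₃) ×
    (∀ e → (¬ (f e ≡ canonical e) → (key e ≡ key e₁ ⊎ key e ≡ key e₂ ⊎ key e ≡ key e₃))
         × ((key e ≡ key e₁ ⊎ key e ≡ key e₂ ⊎ key e ≡ key e₃) → ¬ (f e ≡ canonical e)))

module Submission where

-- Let i₁ = i₀ ⊕ c₁ ⊕ c₂.  The canonical edges i₀ –c₂– (i₀ ⊕ c₂) –c₁– i₁ –c₂– (i₀ ⊕ c₁) form
-- a c₁/c₂-alternating path between the two endpoints of the brick.  Apply the transposition
-- (c₁ c₂) to the colors at each of its four nodes and the identity everywhere else: this is
-- consistent on every edge, because the swapped left nodes {i₀, i₀ ⊕ c₁ ⊕ c₂} are closed under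
-- ⊕ (c₁ ⊕ c₂), and it changes exactly the three edges of the path.  Every node then sees a
-- permutation of its canonical colors, so the coloring stays proper and non-endpoints still
-- see every color, while at the endpoints the missing color c₁ turns into c₂.

open import Defs
open import Data.Nat using (ℕ; zero; suc; _+_; _*_; _^_; _%_; _/_; _≤_; _<_; _≤′_; ≤′-refl; ≤′-step; z≤n; s≤s; s≤s⁻¹)
open import Data.Nat.Properties hiding (_≟_)
open import Data.Nat.Properties using () renaming (_≟_ to _≟ℕ_)
open import Data.Nat.DivMod
open import Data.Nat.Divisibility using (divides)
open import Data.Nat.Induction using (<-rec)
open import Data.Bool using (Bool; true; false)
open import Data.Fin using (Fin; toℕ; fromℕ<; _≟_)
open import Data.Fin.Properties using (toℕ<n; toℕ-fromℕ<; toℕ-injective)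
open import Data.Fin.Permutation using (Permutation′; _⟨$⟩ʳ_; _⟨$⟩ˡ_; inverseʳ; transpose; id)
import Data.Fin.Permutation.Components as PC
open import Data.Product using (Σ; _×_; _,_; proj₁; proj₂; ∃-syntax)
open import Data.Sum using (_⊎_; inj₁; inj₂)
open import Function.Bundles using (_⇔_; mk⇔; Injection)
open import Function.Properties.Inverse using (↔⇒↣)
open import Relation.Nullary using (¬_; Dec; yes; no; does; contradiction)
open import Relation.Nullary.Decidable using (_⊎-dec_; dec-true; dec-false; does-⇔)
open import Relation.Binary.PropositionalEquality

halve-≤ : ∀ {x f} → x * 2 ≤ suc f → x ≤ f
halve-≤ {x} {f} p = s≤s⁻¹ (*-cancelʳ-< 2 x (suc f) (≤-<-trans p (m<m*n (suc f) 2 (s≤s (s≤s z≤n)))))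

halves-≤ : ∀ m n {f} → m + n ≤ suc f → m / 2 + n / 2 ≤ f
halves-≤ m n p = halve-≤ (begin
  (m / 2 + n / 2) * 2   ≡⟨ *-distribʳ-+ 2 (m / 2) (n / 2) ⟩
  m / 2 * 2 + n / 2 * 2 ≤⟨ +-mono-≤ (m/n*n≤m m 2) (m/n*n≤m n 2) ⟩
  m + n                 ≤⟨ p ⟩
  _                     ∎)
  where open ≤-Reasoning

xorAux-suc : ∀ {f m n} → m + n ≤ f → xorAux (suc f) m n ≡ xorAux f m n
xorAux-suc {zero}  {zero} {zero} z≤n = refl
xorAux-suc {suc f} {m}    {n}    p   =
  cong (λ x → (m % 2 + n % 2) % 2 + 2 * x) (xorAux-suc (halves-≤ m n p))

xorAux-fuel : ∀ {f} m n → m + n ≤ f → xorAux f m n ≡ m ⊕ n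
xorAux-fuel m n p = go (≤⇒≤′ p)
  where
  go : ∀ {f} → m + n ≤′ f → xorAux f m n ≡ m ⊕ n
  go ≤′-refl     = refl
  go (≤′-step q) = trans (xorAux-suc (≤′⇒≤ q)) (go q)

⊕-step : ∀ m n → m ⊕ n ≡ (m % 2 + n % 2) % 2 + 2 * (m / 2 ⊕ n / 2)
⊕-step zero    zero    = refl
⊕-step zero    (suc n) =
  cong (λ x → (suc n % 2) % 2 + 2 * x) (xorAux-fuel _ _ (halves-≤ 0 (suc n) ≤-refl))
⊕-step (suc m) n       =
  cong (λ x → (suc m % 2 + n % 2) % 2 + 2 * x) (xorAux-fuel _ _ (halves-≤ (suc m) n ≤-refl))

⊕-%2 : ∀ m n → (m ⊕ n) % 2 ≡ (m + n) % 2
⊕-%2 m n = begin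
  (m ⊕ n) % 2                  ≡⟨ cong (_% 2) (⊕-step m n) ⟩
  (b + 2 * (m / 2 ⊕ n / 2)) % 2 ≡⟨ cong (λ x → (b + x) % 2) (*-comm 2 (m / 2 ⊕ n / 2)) ⟩
  (b + (m / 2 ⊕ n / 2) * 2) % 2 ≡⟨ [m+kn]%n≡m%n b (m / 2 ⊕ n / 2) 2 ⟩
  b % 2                        ≡⟨ m%n%n≡m%n (m % 2 + n % 2) 2 ⟩
  b                            ≡⟨ %-distribˡ-+ m n 2 ⟨
  (m + n) % 2                  ∎
  where
  open ≡-Reasoning
  b = (m % 2 + n % 2) % 2

⊕-/2 : ∀ m n → (m ⊕ n) / 2 ≡ m / 2 ⊕ n / 2
⊕-/2 m n = begin
  (m ⊕ n) / 2            ≡⟨ cong (_/ 2) (⊕-step m n) ⟩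
  (b + 2 * q) / 2        ≡⟨ cong (λ x → (b + x) / 2) (*-comm 2 q) ⟩
  (b + q * 2) / 2        ≡⟨ +-distrib-/-∣ʳ b (divides q refl) ⟩
  b / 2 + q * 2 / 2      ≡⟨ cong₂ _+_ (m<n⇒m/n≡0 (m%n<n (m % 2 + n % 2) 2)) (m*n/n≡m q 2) ⟩
  q                      ∎
  where
  open ≡-Reasoning
  b = (m % 2 + n % 2) % 2
  q = m / 2 ⊕ n / 2

%2-/2-injective : ∀ {x y} → x % 2 ≡ y % 2 → x / 2 ≡ y / 2 → x ≡ y
%2-/2-injective {x} {y} p q = begin
  x                 ≡⟨ m≡m%n+[m/n]*n x 2 ⟩
  x % 2 + x / 2 * 2 ≡⟨ cong₂ (λ r s → r + s * 2) p q ⟩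
  y % 2 + y / 2 * 2 ≡⟨ m≡m%n+[m/n]*n y 2 ⟨
  y                 ∎
  where open ≡-Reasoning

binary-induction : (P : ℕ → Set) → P 0 → (∀ n → P (suc n / 2) → P (suc n)) → ∀ n → P n
binary-induction P P0 step = <-rec P λ where
  zero    _   → P0
  (suc n) rec → step n (rec (m/n<m (suc n) 2 (s≤s (s≤s z≤n))))

%2-cong-+ : ∀ {x x′ y y′} → x % 2 ≡ x′ % 2 → y % 2 ≡ y′ % 2 → (x + y) % 2 ≡ (x′ + y′) % 2
%2-cong-+ {x} {x′} {y} {y′} p q = begin
  (x + y) % 2             ≡⟨ %-distribˡ-+ x y 2 ⟩
  (x % 2 + y % 2) % 2     ≡⟨ cong₂ (λ r s → (r + s) % 2) p q ⟩
  (x′ % 2 + y′ % 2) % 2   ≡⟨ %-distribˡ-+ x′ y′ 2 ⟨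
  (x′ + y′) % 2           ∎
  where open ≡-Reasoning

xorAux-comm : ∀ f m n → xorAux f m n ≡ xorAux f n m
xorAux-comm zero    m n = refl
xorAux-comm (suc f) m n =
  cong₂ (λ r s → r % 2 + 2 * s) (+-comm (m % 2) (n % 2)) (xorAux-comm f (m / 2) (n / 2))

⊕-comm : ∀ m n → m ⊕ n ≡ n ⊕ m
⊕-comm m n = trans (xorAux-comm (m + n) m n) (cong (λ f → xorAux f n m) (+-comm m n))

⊕-identityˡ : ∀ n → 0 ⊕ n ≡ n
⊕-identityˡ = binary-induction (λ n → 0 ⊕ n ≡ n) refl λ n ih →
  %2-/2-injective (⊕-%2 0 (suc n)) (trans (⊕-/2 0 (suc n)) ih)

⊕-identityʳ : ∀ n → n ⊕ 0 ≡ n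
⊕-identityʳ n = trans (⊕-comm n 0) (⊕-identityˡ n)

n⊕n≡0 : ∀ n → n ⊕ n ≡ 0
n⊕n≡0 = binary-induction (λ n → n ⊕ n ≡ 0) refl λ n ih →
  %2-/2-injective (trans (⊕-%2 (suc n) (suc n)) (n+n%2≡0 (suc n))) (trans (⊕-/2 (suc n) (suc n)) ih)
  where
  n+n%2≡0 : ∀ n → (n + n) % 2 ≡ 0
  n+n%2≡0 n = trans (cong (λ x → (n + x) % 2) (sym (+-identityʳ n))) (trans (cong (_% 2) (*-comm 2 n)) (m*n%n≡0 n 2))

⊕-assoc : ∀ a b c → (a ⊕ b) ⊕ c ≡ a ⊕ (b ⊕ c)
⊕-assoc = binary-induction (λ a → ∀ b c → (a ⊕ b) ⊕ c ≡ a ⊕ (b ⊕ c)) base step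
  where
  base : ∀ b c → (0 ⊕ b) ⊕ c ≡ 0 ⊕ (b ⊕ c)
  base b c = trans (cong (_⊕ c) (⊕-identityˡ b)) (sym (⊕-identityˡ (b ⊕ c)))
  step : ∀ n → (∀ b c → (suc n / 2 ⊕ b) ⊕ c ≡ suc n / 2 ⊕ (b ⊕ c)) →
         ∀ b c → (suc n ⊕ b) ⊕ c ≡ suc n ⊕ (b ⊕ c)
  step n ih b c = %2-/2-injective
    (begin
      ((a ⊕ b) ⊕ c) % 2  ≡⟨ ⊕-%2 (a ⊕ b) c ⟩
      ((a ⊕ b) + c) % 2  ≡⟨ %2-cong-+ {a ⊕ b} {a + b} {c} (⊕-%2 a b) refl ⟩
      (a + b + c) % 2    ≡⟨ cong (_% 2) (+-assoc a b c) ⟩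
      (a + (b + c)) % 2  ≡⟨ %2-cong-+ {a} {a} {b ⊕ c} {b + c} refl (⊕-%2 b c) ⟨
      (a + (b ⊕ c)) % 2  ≡⟨ ⊕-%2 a (b ⊕ c) ⟨
      (a ⊕ (b ⊕ c)) % 2  ∎)
    (begin
      ((a ⊕ b) ⊕ c) / 2          ≡⟨ ⊕-/2 (a ⊕ b) c ⟩
      (a ⊕ b) / 2 ⊕ c / 2        ≡⟨ cong (_⊕ c / 2) (⊕-/2 a b) ⟩
      (a / 2 ⊕ b / 2) ⊕ c / 2    ≡⟨ ih (b / 2) (c / 2) ⟩
      a / 2 ⊕ (b / 2 ⊕ c / 2)    ≡⟨ cong (a / 2 ⊕_) (⊕-/2 b c) ⟨
      a / 2 ⊕ (b ⊕ c) / 2        ≡⟨ ⊕-/2 a (b ⊕ c) ⟨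
      (a ⊕ (b ⊕ c)) / 2          ∎)
    where
    open ≡-Reasoning
    a = suc n

⊕-cancelʳ : ∀ m n → (m ⊕ n) ⊕ n ≡ m
⊕-cancelʳ m n = trans (⊕-assoc m n n) (trans (cong (m ⊕_) (n⊕n≡0 n)) (⊕-identityʳ m))

/2<⇒<2* : ∀ {x t} → x / 2 < t → x < 2 * t
/2<⇒<2* {x} {t} p = begin-strict
  x                 ≡⟨ m≡m%n+[m/n]*n x 2 ⟩
  x % 2 + x / 2 * 2 <⟨ +-monoˡ-< (x / 2 * 2) (m%n<n x 2) ⟩
  suc (x / 2) * 2   ≤⟨ *-monoˡ-≤ 2 p ⟩
  t * 2             ≡⟨ *-comm t 2 ⟩
  2 * t             ∎
  where open ≤-Reasoning

⊕-<-2^ : ∀ e {m n} → m < 2 ^ e → n < 2 ^ e → m ⊕ n < 2 ^ e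
⊕-<-2^ zero    {zero}  {zero}  _         _         = s≤s z≤n
⊕-<-2^ zero    {suc m} {_}     (s≤s ()) _
⊕-<-2^ zero    {zero}  {suc n} _         (s≤s ())
⊕-<-2^ (suc e) {m}     {n}     p         q         =
  /2<⇒<2* (subst (_< 2 ^ e) (sym (⊕-/2 m n)) (⊕-<-2^ e (halve p) (halve q)))
  where
  halve : ∀ {x} → x < 2 * 2 ^ e → x / 2 < 2 ^ e
  halve {x} p = m<n*o⇒m/o<n (subst (x <_) (*-comm 2 (2 ^ e)) p)

⊕-moveʳ : ∀ {m n p} → m ⊕ n ≡ p → m ≡ p ⊕ n
⊕-moveʳ {m} {n} e = trans (sym (⊕-cancelʳ m n)) (cong (_⊕ n) e)

⊕-injectiveʳ : ∀ {m m′} n → m ⊕ n ≡ m′ ⊕ n → m ≡ m′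
⊕-injectiveʳ {m′ = m′} n e = trans (⊕-moveʳ e) (⊕-cancelʳ m′ n)

⊕-injectiveˡ : ∀ m {n n′} → m ⊕ n ≡ m ⊕ n′ → n ≡ n′
⊕-injectiveˡ m {n} {n′} e = ⊕-injectiveʳ m (trans (⊕-comm n m) (trans e (⊕-comm m n′)))

⊕-pair-closed : ∀ a d x → (x ⊕ d ≡ a ⊎ x ⊕ d ≡ a ⊕ d) ⇔ (x ≡ a ⊎ x ≡ a ⊕ d)
⊕-pair-closed a d x = mk⇔ to from
  where
  to : x ⊕ d ≡ a ⊎ x ⊕ d ≡ a ⊕ d → x ≡ a ⊎ x ≡ a ⊕ d
  to (inj₁ e) = inj₂ (⊕-moveʳ e)
  to (inj₂ e) = inj₁ (⊕-injectiveʳ d e)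
  from : x ≡ a ⊎ x ≡ a ⊕ d → x ⊕ d ≡ a ⊎ x ⊕ d ≡ a ⊕ d
  from (inj₁ refl) = inj₂ refl
  from (inj₂ refl) = inj₁ (⊕-cancelʳ a d)

transpose-matchˡ : ∀ {n} (i j : Fin n) → PC.transpose i j i ≡ j
transpose-matchˡ i j rewrite dec-true (i ≟ i) refl = refl

transpose-matchʳ : ∀ {n} {i j : Fin n} → ¬ j ≡ i → PC.transpose i j j ≡ i
transpose-matchʳ {i = i} {j} j≢i rewrite dec-false (j ≟ i) j≢i | dec-true (j ≟ j) refl = refl

transpose-fix : ∀ {n} {i j l : Fin n} → ¬ l ≡ i → ¬ l ≡ j → PC.transpose i j l ≡ l
transpose-fix {i = i} {j} {l} l≢i l≢j rewrite dec-false (l ≟ i) l≢i | dec-false (l ≟ j) l≢j = refl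

module _ {w k : ℕ} {i₀ : Fin w} {c₁ : Fin k} where

  canonical-injective-at : ∀ v (e e′ : BrickEdge w k i₀ c₁) → Incident v e → Incident v e′ →
                           canonical e ≡ canonical e′ → key e ≡ key e′
  canonical-injective-at (inj₁ _) ((i , c) , _) ((.i , .c) , _) refl refl refl = refl
  canonical-injective-at (inj₂ j) ((i , c) , _) ((i′ , .c) , _) j≡ j≡′ refl =
    cong (_, c) (toℕ-injective (⊕-injectiveʳ (toℕ c) (trans (sym j≡) j≡′)))

  endpoint-misses-c₁ : ∀ v (e : BrickEdge w k i₀ c₁) → IsEndpoint {i₀ = i₀} {c₁ = c₁} v →
                       Incident v e → ¬ canonical e ≡ c₁
  endpoint-misses-c₁ (inj₁ _) ((i , c) , not-deleted) refl refl c≡c₁ = not-deleted (refl , c≡c₁)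
  endpoint-misses-c₁ (inj₂ j) ((i , c) , not-deleted) j≡ j≡′ refl =
    not-deleted (toℕ-injective (⊕-injectiveʳ (toℕ c₁) (trans (sym j≡′) j≡)) , refl)

module XorClosed {w k : ℕ} (⊕-closed : ∀ (i : Fin w) (c : Fin k) → toℕ i ⊕ toℕ c < w) where

  _⊕ᶠ_ : Fin w → Fin k → Fin w
  i ⊕ᶠ c = fromℕ< (⊕-closed i c)

  toℕ-⊕ᶠ : ∀ i c → toℕ (i ⊕ᶠ c) ≡ toℕ i ⊕ toℕ c
  toℕ-⊕ᶠ i c = toℕ-fromℕ< (⊕-closed i c)

  canonical-surjective-at : ∀ {i₀ : Fin w} {c₁ : Fin k} v → ¬ IsEndpoint {i₀ = i₀} {c₁ = c₁} v →
                            ∀ c → Σ (BrickEdge w k i₀ c₁) λ e → Incident v e × canonical e ≡ c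
  canonical-surjective-at (inj₁ i) not-endpoint c =
    ((i , c) , λ (i≡i₀ , _) → not-endpoint i≡i₀) , refl , refl
  canonical-surjective-at {i₀} {c₁} (inj₂ j) not-endpoint c =
    ((j ⊕ᶠ c , c) , not-deleted) , j≡ , refl
    where
    j≡ : toℕ j ≡ toℕ (j ⊕ᶠ c) ⊕ toℕ c
    j≡ = ⊕-moveʳ (sym (toℕ-⊕ᶠ j c))
    not-deleted : ¬ (j ⊕ᶠ c ≡ i₀ × c ≡ c₁)
    not-deleted (l≡i₀ , refl) = not-endpoint (subst (λ l → toℕ j ≡ toℕ l ⊕ toℕ c) l≡i₀ j≡)

  module KempeSwap (i₀ : Fin w) (c₁ c₂ : Fin k) (c₂≢c₁ : ¬ c₂ ≡ c₁) where

    δ : ℕ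
    δ = toℕ c₁ ⊕ toℕ c₂

    i₁ : Fin w
    i₁ = (i₀ ⊕ᶠ c₁) ⊕ᶠ c₂

    toℕ-i₁ : toℕ i₁ ≡ toℕ i₀ ⊕ δ
    toℕ-i₁ = begin
      toℕ ((i₀ ⊕ᶠ c₁) ⊕ᶠ c₂)     ≡⟨ toℕ-⊕ᶠ (i₀ ⊕ᶠ c₁) c₂ ⟩
      toℕ (i₀ ⊕ᶠ c₁) ⊕ toℕ c₂    ≡⟨ cong (_⊕ toℕ c₂) (toℕ-⊕ᶠ i₀ c₁) ⟩
      toℕ i₀ ⊕ toℕ c₁ ⊕ toℕ c₂   ≡⟨ ⊕-assoc (toℕ i₀) (toℕ c₁) (toℕ c₂) ⟩
      toℕ i₀ ⊕ δ                 ∎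
      where open ≡-Reasoning

    i₁≢i₀ : ¬ i₁ ≡ i₀
    i₁≢i₀ i₁≡i₀ = c₂≢c₁ (toℕ-injective (sym (trans (⊕-moveʳ δ≡0) (⊕-identityˡ (toℕ c₂)))))
      where
      δ≡0 : δ ≡ 0
      δ≡0 = ⊕-injectiveˡ (toℕ i₀) (trans (sym toℕ-i₁) (trans (cong toℕ i₁≡i₀) (sym (⊕-identityʳ (toℕ i₀)))))

    Swapped : ℕ → Set
    Swapped x = x ≡ toℕ i₀ ⊎ x ≡ toℕ i₀ ⊕ δ

    swapped? : ∀ x → Dec (Swapped x)
    swapped? x = (x ≟ℕ toℕ i₀) ⊎-dec (x ≟ℕ toℕ i₀ ⊕ δ)

    σ : Bool → Permutation′ k
    σ true  = transpose c₁ c₂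
    σ false = id

    recolor : ℕ → Permutation′ k
    recolor x = σ (does (swapped? x))

    recolor-swapped : ∀ {x} → Swapped x → ∀ c → recolor x ⟨$⟩ʳ c ≡ PC.transpose c₁ c₂ c
    recolor-swapped {x} s c rewrite dec-true (swapped? x) s = refl

    recolor-unswapped : ∀ {x} → ¬ Swapped x → ∀ c → recolor x ⟨$⟩ʳ c ≡ c
    recolor-unswapped {x} ¬s c rewrite dec-false (swapped? x) ¬s = refl

    σ-fix : ∀ b {c} → ¬ c ≡ c₁ → ¬ c ≡ c₂ → σ b ⟨$⟩ʳ c ≡ c
    σ-fix true  c≢c₁ c≢c₂ = transpose-fix c≢c₁ c≢c₂
    σ-fix false _    _    = refl

    recolor-fix : ∀ x {c} → ¬ c ≡ c₁ → ¬ c ≡ c₂ → recolor x ⟨$⟩ʳ c ≡ c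
    recolor-fix x = σ-fix (does (swapped? x))

    recolor-agrees : ∀ x c → recolor x ⟨$⟩ʳ c ≡ recolor ((x ⊕ toℕ c) ⊕ toℕ c₁) ⟨$⟩ʳ c
    recolor-agrees x c with c ≟ c₁ | c ≟ c₂
    ... | yes refl | _ = cong (λ y → recolor y ⟨$⟩ʳ c₁) (sym (⊕-cancelʳ x (toℕ c₁)))
    ... | no _ | yes refl = begin
      recolor x ⟨$⟩ʳ c₂                           ≡⟨ cong (λ b → σ b ⟨$⟩ʳ c₂) swapped-⊕δ ⟨
      recolor (x ⊕ δ) ⟨$⟩ʳ c₂                     ≡⟨ cong (λ y → recolor y ⟨$⟩ʳ c₂) x⊕δ ⟩
      recolor ((x ⊕ toℕ c₂) ⊕ toℕ c₁) ⟨$⟩ʳ c₂     ∎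
      where
      open ≡-Reasoning
      swapped-⊕δ : does (swapped? (x ⊕ δ)) ≡ does (swapped? x)
      swapped-⊕δ = does-⇔ (⊕-pair-closed (toℕ i₀) δ x) (swapped? (x ⊕ δ)) (swapped? x)
      x⊕δ : x ⊕ δ ≡ (x ⊕ toℕ c₂) ⊕ toℕ c₁
      x⊕δ = sym (trans (⊕-assoc x (toℕ c₂) (toℕ c₁)) (cong (x ⊕_) (⊕-comm (toℕ c₂) (toℕ c₁))))
    ... | no c≢c₁ | no c≢c₂ =
      trans (recolor-fix x c≢c₁ c≢c₂) (sym (recolor-fix ((x ⊕ toℕ c) ⊕ toℕ c₁) c≢c₁ c≢c₂))

    recolor-to-c₂ : ∀ {x c} → Swapped x → recolor x ⟨$⟩ʳ c ≡ c₂ → c ≡ c₁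
    recolor-to-c₂ {x} {c} s ≡c₂ = begin
      c                                        ≡⟨ PC.transpose-inverse c₂ c₁ ⟨
      PC.transpose c₂ c₁ (PC.transpose c₁ c₂ c) ≡⟨ cong (PC.transpose c₂ c₁) (trans (sym (recolor-swapped s c)) ≡c₂) ⟩
      PC.transpose c₂ c₁ c₂                    ≡⟨ transpose-matchˡ c₂ c₁ ⟩
      c₁                                       ∎
      where open ≡-Reasoning

    recolor-moves : ∀ x c → ¬ recolor x ⟨$⟩ʳ c ≡ c → Swapped x × (c ≡ c₁ ⊎ c ≡ c₂)
    recolor-moves x c moved with swapped? x | c ≟ c₁ | c ≟ c₂
    ... | no ¬s | _        | _        = contradiction (recolor-unswapped ¬s c) moved
    ... | yes s | yes c≡c₁ | _        = s , inj₁ c≡c₁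
    ... | yes s | no _     | yes c≡c₂ = s , inj₂ c≡c₂
    ... | yes _ | no c≢c₁  | no c≢c₂  = contradiction (recolor-fix x c≢c₁ c≢c₂) moved

    recolor-moves-back : ∀ {x c} → Swapped x → c ≡ c₁ ⊎ c ≡ c₂ → ¬ recolor x ⟨$⟩ʳ c ≡ c
    recolor-moves-back s (inj₁ refl) fixed =
      c₂≢c₁ (trans (sym (trans (recolor-swapped s c₁) (transpose-matchˡ c₁ c₂))) fixed)
    recolor-moves-back s (inj₂ refl) fixed =
      c₂≢c₁ (sym (trans (sym (trans (recolor-swapped s c₂) (transpose-matchʳ c₂≢c₁))) fixed))

    -- Whether colors are swapped at a node is decided on the left: a right node j is
    -- represented by the left node j ⊕ c₁ joined to it by a canonical c₁-edge.
    anchor : Node w → ℕ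
    anchor (inj₁ i) = toℕ i
    anchor (inj₂ j) = toℕ j ⊕ toℕ c₁

    anchor-endpoint : ∀ v → IsEndpoint {i₀ = i₀} {c₁ = c₁} v → anchor v ≡ toℕ i₀
    anchor-endpoint (inj₁ _) refl = refl
    anchor-endpoint (inj₂ j) j≡   = trans (cong (_⊕ toℕ c₁) j≡) (⊕-cancelʳ (toℕ i₀) (toℕ c₁))

    coloring : Coloring {w} {k} {i₀} {c₁}
    coloring ((i , c) , _) = recolor (toℕ i) ⟨$⟩ʳ c

    coloring-at : ∀ v e → Incident v e → coloring e ≡ recolor (anchor v) ⟨$⟩ʳ canonical e
    coloring-at (inj₁ _) _             refl = refl
    coloring-at (inj₂ j) ((i , c) , _) j≡   =
      trans (recolor-agrees (toℕ i) c) (cong (λ y → recolor (y ⊕ toℕ c₁) ⟨$⟩ʳ c) (sym j≡))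

    proper : Proper coloring
    proper v e e′ inc inc′ key≢ same = key≢ (canonical-injective-at v e e′ inc inc′ (injective
      (trans (sym (coloring-at v e inc)) (trans same (coloring-at v e′ inc′)))))
      where open Injection (↔⇒↣ (recolor (anchor v)))

    endpoints-miss-c₂ : ∀ v → IsEndpoint {i₀ = i₀} {c₁ = c₁} v → ∀ e → Incident v e → ¬ coloring e ≡ c₂
    endpoints-miss-c₂ v endpoint e inc ≡c₂ = endpoint-misses-c₁ v e endpoint inc
      (recolor-to-c₂ (inj₁ (anchor-endpoint v endpoint)) (trans (sym (coloring-at v e inc)) ≡c₂))

    others-see-all : ∀ v → ¬ IsEndpoint {i₀ = i₀} {c₁ = c₁} v → ∀ c → ∃[ e ] (Incident v e × coloring e ≡ c)
    others-see-all v not-endpoint c with canonical-surjective-at v not-endpoint (recolor (anchor v) ⟨$⟩ˡ c)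
    ... | e , inc , can = e , inc , (begin
      coloring e                                         ≡⟨ coloring-at v e inc ⟩
      recolor (anchor v) ⟨$⟩ʳ canonical e                 ≡⟨ cong (recolor (anchor v) ⟨$⟩ʳ_) can ⟩
      recolor (anchor v) ⟨$⟩ʳ (recolor (anchor v) ⟨$⟩ˡ c) ≡⟨ inverseʳ (recolor (anchor v)) ⟩
      c                                                   ∎)
      where open ≡-Reasoning

    e₁ e₂ e₃ : BrickEdge w k i₀ c₁
    e₁ = (i₀ , c₂) , λ (_ , c₂≡c₁) → c₂≢c₁ c₂≡c₁
    e₂ = (i₁ , c₂) , λ (_ , c₂≡c₁) → c₂≢c₁ c₂≡c₁
    e₃ = (i₁ , c₁) , λ (i₁≡i₀ , _) → i₁≢i₀ i₁≡i₀

    swapped-left : ∀ i → Swapped (toℕ i) → i ≡ i₀ ⊎ i ≡ i₁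
    swapped-left i (inj₁ i≡i₀) = inj₁ (toℕ-injective i≡i₀)
    swapped-left i (inj₂ i≡i₁) = inj₂ (toℕ-injective (trans i≡i₁ (sym toℕ-i₁)))

    changed : ChangedExactly coloring e₁ e₂ e₃
    changed =
        (λ eq → i₁≢i₀ (sym (cong proj₁ eq)))
      , (λ eq → c₂≢c₁ (cong proj₂ eq))
      , (λ eq → c₂≢c₁ (cong proj₂ eq))
      , λ e → recolored⇒ e , ⇒recolored e
      where
      recolored⇒ : ∀ e → ¬ coloring e ≡ canonical e → key e ≡ key e₁ ⊎ key e ≡ key e₂ ⊎ key e ≡ key e₃
      recolored⇒ ((i , c) , not-deleted) moved with recolor-moves (toℕ i) c moved
      ... | s , c∈ with swapped-left i s | c∈
      ... | inj₁ refl | inj₁ refl = contradiction (refl , refl) not-deleted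
      ... | inj₁ refl | inj₂ refl = inj₁ refl
      ... | inj₂ refl | inj₂ refl = inj₂ (inj₁ refl)
      ... | inj₂ refl | inj₁ refl = inj₂ (inj₂ refl)

      ⇒recolored : ∀ e → key e ≡ key e₁ ⊎ key e ≡ key e₂ ⊎ key e ≡ key e₃ → ¬ coloring e ≡ canonical e
      ⇒recolored _ (inj₁ refl)        = recolor-moves-back (inj₁ refl) (inj₂ refl)
      ⇒recolored _ (inj₂ (inj₁ refl)) = recolor-moves-back (inj₂ toℕ-i₁) (inj₂ refl)
      ⇒recolored _ (inj₂ (inj₂ refl)) = recolor-moves-back (inj₂ toℕ-i₁) (inj₁ refl)

    kempe-recoloring : Σ (Coloring {w} {k} {i₀} {c₁}) λ f →
      Proper f
      × (∃[ e₁ ] ∃[ e₂ ] ∃[ e₃ ] ChangedExactly f e₁ e₂ e₃)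
      × (∀ v → IsEndpoint {w} {k} {i₀} {c₁} v → ∀ e → Incident v e → ¬ (f e ≡ c₂))
      × (∀ v → ¬ IsEndpoint {w} {k} {i₀} {c₁} v → ∀ c → ∃[ e ] (Incident v e × f e ≡ c))
    kempe-recoloring = coloring , proper , (e₁ , e₂ , e₃ , changed) , endpoints-miss-c₂ , others-see-all

lemma14 : (k w : ℕ) → 2 ≤ k → (Σ ℕ λ m → w ≡ 2 ^ m) → w < 2 * k → k ≤ w →
    (i₀ : Fin w) (c₁ c₂ : Fin k) → ¬ (c₂ ≡ c₁) →
    Σ (Coloring {w} {k} {i₀} {c₁}) λ f →
      Proper f
      × (∃[ e₁ ] ∃[ e₂ ] ∃[ e₃ ] ChangedExactly f e₁ e₂ e₃)
      × (∀ v → IsEndpoint {w} {k} {i₀} {c₁} v → ∀ e → Incident v e → ¬ (f e ≡ c₂))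
      × (∀ v → ¬ IsEndpoint {w} {k} {i₀} {c₁} v → ∀ c → ∃[ e ] (Incident v e × f e ≡ c))
lemma14 k w _ (m , refl) _ k≤w i₀ c₁ c₂ c₂≢c₁ = KempeSwap.kempe-recoloring i₀ c₁ c₂ c₂≢c₁
  where open XorClosed (λ i c → ⊕-<-2^ m (toℕ<n i) (<-≤-trans (toℕ<n c) k≤w))
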